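{- Let $G$ be a game with $\mathrm{opts}(G) \subset \mathscr{A}$, and suppose that \[\Phi''H \subset \Phi''G \subset \mathcal{M}_x,\] for some $H \in \mathscr{A}$ ($H \neq 0$) with $\Phi(H) = x$. Let $F$ and $F^+$ be the mex functions for $T(\mathscr{A})$ and $T(\mathscr{A} \cup \{G\})$, respectively. Then $F = F^+$.
   Context: Fix a closed set $\mathscr{A}$ of impartial games (closed under addition and under taking options), with misère quotient $(\mathcal{Q},\mathcal{P}) = \mathcal{Q}(\mathscr{A})$ (the reduction of the bipartite monoid of $\mathscr{A}$ with its misère $\mathscr{P}$-positions; $\mathcal{P}$ is the set of images of misère $\mathscr{P}$-positions) and quotient map $\Phi : \mathscr{A} \to \mathcal{Q}$. For a game $G$ whose options lie in $\mathscr{A}$, write $\Phi''G = \{\Phi(G') : G' \text{ an option of } G\}$. For $x \in \mathcal{Q}$, the meximal set is $\mathcal{M}_x = \{y \in \mathcal{Q} : \text{there is no } z \in \mathcal{Q} \text{ with both } xz, yz \in \mathcal{P}\}$. The transition algebra is $T(\mathscr{A}) = \{(\Phi(G),\Phi''G) : G \in \mathscr{A}\}$. The mex function $F$ for $T(\mathscr{A})$ is the partial function from subsets of $\mathcal{Q}$ to $\mathcal{Q}$ defined by: $F(\mathcal{D}) = w$ iff $\mathcal{D} \subset \mathcal{M}_w$ and, for each $(y,\mathcal{E}) \in T(\mathscr{A})$ and each $n \geq 0$ with $w^{n+1}y \notin \mathcal{P}$, either $w^{n+1}y' \in \mathcal{P}$ for some $y' \in \mathcal{E}$, or $w^n w'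 y \in \mathcal{P}$ for some $w' \in \mathcal{D}$. (Equivalently, for a nonzero game $G$ with options in $\mathscr{A}$, $F(\Phi''G)$ is defined iff the quotient of the closure of $\mathscr{A} \cup \{G\}$ is isomorphic to $\mathcal{Q}(\mathscr{A})$, and then $\Phi(G) = F(\Phi''G)$.) Under the hypotheses, the quotient does not change when $G$ is adjoined, so $\Phi$ extends to the closure of $\mathscr{A}\cup\{G\}$ and $F^+$ is defined in the same way using $T(\mathscr{A} \cup \{G\})$. -}

module Defs where

open import Data.Bool using (Bool; true; false; not; _∧_)
open import Data.Nat using (ℕ; zero; suc)
open import Data.List using (List; []; _∷_; _++_)
open import Data.List.Membership.Propositional using (_∈_)
open import Data.Product using (Σ; ∃; _×_; _,_)
open import Data.Sum using (_⊎_)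
open import Relation.Nullary using (¬_)
open import Relation.Binary.PropositionalEquality using (_≡_)

data Game : Set where
  mk : List Game → Game

opts : Game → List Game
opts (mk gs) = gs

_∈opt_ : Game → Game → Set
K' ∈opt K = K' ∈ opts K

𝟘 : Game
𝟘 = mk []

NonZeroGame : Game → Set
NonZeroGame K = ∃ λ K' → K' ∈opt K

mutual
  _⊕_ : Game → Game → Game
  mk gs ⊕ mk hs = mk (lefts gs (mk hs) ++ rights (mk gs) hs)

  lefts : List Game → Game → List Game
  lefts []       h = []
  lefts (g ∷ gs) h = (g ⊕ h) ∷ lefts gs h

  rights : Game → List Game → List Game
  rights g []       = []
  rights g (h ∷ hs) = (g ⊕ h) ∷ rights g hs

infixl 6 _⊕_

times : ℕ → Game → Game
times zero    W = 𝟘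
times (suc n) W = W ⊕ times n W

-- Misère outcome: isP K = true iff K is a misère P-position
-- (the player to move loses playing misère; a game with no moves is an N-position).

mutual
  isP : Game → Bool
  isP (mk [])       = false
  isP (mk (g ∷ gs)) = allN (g ∷ gs)

  allN : List Game → Bool
  allN []       = true
  allN (g ∷ gs) = not (isP g) ∧ allN gs

Closed : (Game → Set) → Set
Closed 𝒜 = (∀ K L → 𝒜 K → 𝒜 L → 𝒜 (K ⊕ L))
         × (∀ K K' → 𝒜 K → K' ∈opt K → 𝒜 K')

data Cl (𝒜 : Game → Set) (G : Game) : Game → Set where
  base : ∀ {K} → 𝒜 K → Cl 𝒜 G K
  gen  : Cl 𝒜 G G
  sum  : ∀ {K L} → Cl 𝒜 G K → Cl 𝒜 G L → Cl 𝒜 G (K ⊕ L)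
  opt  : ∀ {K K'} → Cl 𝒜 G K → K' ∈opt K → Cl 𝒜 G K'

-- The misère quotient Q(𝒜), represented by games of 𝒜 modulo
-- indistinguishability: Φ(X) = Φ(Y) iff X ≈[ 𝒜 ] Y.

_≈[_]_ : Game → (Game → Set) → Game → Set
X ≈[ 𝒜 ] Y = ∀ Z → 𝒜 Z → isP (X ⊕ Z) ≡ isP (Y ⊕ Z)

-- Meximal set: Φ(Y) ∈ 𝓜_{Φ(X)} iff there is no z ∈ Q (z = Φ(Z), Z ∈ 𝒜)
-- with xz, yz ∈ 𝒫 (i.e. X + Z, Y + Z misère P-positions).
InM : (Game → Set) → Game → Game → Set
InM 𝒜 X Y = ¬ (Σ Game λ Z → 𝒜 Z × isP (X ⊕ Z) ≡ true × isP (Y ⊕ Z) ≡ true)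

-- Parameters:
--   𝒜 : the closed set whose quotient Q = Q(𝒜) is used (elements = Φ(W), W ∈ 𝒜),
--   𝒯 : the set of games whose pairs (Φ(K), Φ''K) form the transition algebra,
--   𝒟 : a subset of Q, given as a predicate on representatives in 𝒜,
--   W : representative of w ∈ Q.
-- IsMex 𝒜 𝒯 𝒟 W  means  F(𝒟) = w  for the mex function of T(𝒯).
-- The condition "w^{n+1} y ∈ 𝒫" with y = Φ(K) is the statement that the game
-- (n+1)·W + K is a misère P-position (Φ is a monoid hom and 𝒫 is the image of
-- the P-positions, also for the extended map Φ on the closure).

IsMex : (Game → Set) → (Game → Set) → (Game → Set) → Game → Set
IsMex 𝒜 𝒯 𝒟 W =
    (∀ Y → 𝒜 Y → 𝒟 Y → InM 𝒜 W Y)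
  × (∀ K → 𝒯 K → ∀ n → isP (times (suc n) W ⊕ K) ≡ false →
       (Σ Game λ K' → K' ∈opt K × isP (times (suc n) W ⊕ K') ≡ true)
     ⊎ (Σ Game λ W' → 𝒜 W' × 𝒟 W' × isP (times n W ⊕ W' ⊕ K) ≡ true))

-- In every sum j·G + A with A ∈ 𝒜 the copies of G may be replaced by copies of H without changing
-- misère outcomes.  This goes by induction on j, comparing G + j·G with H + j·G in every context
-- A ∈ 𝒜 by induction on A: a move of H is matched, up to indistinguishability, by a move of G
-- (Φ''H ⊆ Φ''G), and no move of G reaches a P-position while H + j·G + A is one (Φ''G ⊆ 𝓜ₓ).
-- Every game of the closure of 𝒜 ∪ {G} is some k·G + A, hence indistinguishable from k·H + A ∈ 𝒜,
-- whose options are matched by options of k·G + A; so each clause of the mex condition for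
-- T(𝒜 ∪ {G}) follows from the one for T(𝒜), and the converse holds because T(𝒜) ⊆ T(𝒜 ∪ {G}).

module Submission where

open import Algebra.Bundles using (CommutativeMonoid)
open import Algebra.Structures using (IsCommutativeMonoid)
open import Data.Bool using (true; false)
open import Data.Bool.Properties using (⇔→≡; ¬-not)
open import Data.List using ([]; _∷_; _++_; map)
open import Data.List.Membership.Propositional using (_∈_)
open import Data.List.Membership.Propositional.Properties
  using (∈-map⁺; ∈-map⁻; ∈-++⁺ˡ; ∈-++⁺ʳ; ∈-++⁻)
open import Data.List.Relation.Unary.Any using (here; there)
open import Data.Nat using (ℕ; zero; suc; _+_)
open import Data.Product using (Σ; _×_; _,_; proj₁; proj₂)
open import Data.Sum as Sum using (_⊎_; inj₁; inj₂)
open import Function using (_∘_)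
open import Function.Bundles using (_⇔_; mk⇔)
open import Relation.Binary.Bundles using (Setoid)
open import Relation.Binary.PropositionalEquality
  using (_≡_; refl; sym; trans; cong; cong₂; subst; module ≡-Reasoning)
import Relation.Binary.Reasoning.Setoid as SetoidReasoning

open import Defs

mutual
  game-ind : (P : Game → Set) → (∀ X → (∀ X' → X' ∈opt X → P X') → P X) → ∀ X → P X
  game-ind P step (mk xs) = step (mk xs) (game-ind-∈ P step xs)

  game-ind-∈ : (P : Game → Set) → (∀ X → (∀ X' → X' ∈opt X → P X') → P X)
    → ∀ xs X' → X' ∈ xs → P X'
  game-ind-∈ P step (x ∷ xs) .x (here refl) = game-ind P step x
  game-ind-∈ P step (x ∷ xs) X' (there m)   = game-ind-∈ P step xs X' m

opts-⊕ : ∀ X Y → opts (X ⊕ Y) ≡ map (_⊕ Y) (opts X) ++ map (X ⊕_) (opts Y)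
opts-⊕ (mk xs) (mk ys) = cong₂ _++_ (lefts≡map xs) (rights≡map ys)
  where
  lefts≡map : ∀ xs → lefts xs (mk ys) ≡ map (_⊕ mk ys) xs
  lefts≡map []       = refl
  lefts≡map (x ∷ xs) = cong (x ⊕ mk ys ∷_) (lefts≡map xs)

  rights≡map : ∀ ys' → rights (mk xs) ys' ≡ map (mk xs ⊕_) ys'
  rights≡map []       = refl
  rights≡map (y ∷ ys') = cong (mk xs ⊕ y ∷_) (rights≡map ys')

∈opt-⊕⁻ : ∀ X Y {K} → K ∈opt (X ⊕ Y) →
  (Σ Game λ X' → X' ∈opt X × K ≡ X' ⊕ Y) ⊎ (Σ Game λ Y' → Y' ∈opt Y × K ≡ X ⊕ Y')
∈opt-⊕⁻ X Y {K} k with ∈-++⁻ (map (_⊕ Y) (opts X)) (subst (K ∈_) (opts-⊕ X Y) k)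
... | inj₁ k' = inj₁ (∈-map⁻ (_⊕ Y) k')
... | inj₂ k' = inj₂ (∈-map⁻ (X ⊕_) k')

∈opt-⊕⁺ˡ : ∀ X Y {X'} → X' ∈opt X → (X' ⊕ Y) ∈opt (X ⊕ Y)
∈opt-⊕⁺ˡ X Y x' = subst (_ ∈_) (sym (opts-⊕ X Y)) (∈-++⁺ˡ (∈-map⁺ (_⊕ Y) x'))

∈opt-⊕⁺ʳ : ∀ X Y {Y'} → Y' ∈opt Y → (X ⊕ Y') ∈opt (X ⊕ Y)
∈opt-⊕⁺ʳ X Y y' =
  subst (_ ∈_) (sym (opts-⊕ X Y)) (∈-++⁺ʳ (map (_⊕ Y) (opts X)) (∈-map⁺ (X ⊕_) y'))

∈opt-⊕-elim : ∀ (P : Game → Set) X Y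
  → (∀ X' → X' ∈opt X → P (X' ⊕ Y)) → (∀ Y' → Y' ∈opt Y → P (X ⊕ Y'))
  → ∀ K → K ∈opt (X ⊕ Y) → P K
∈opt-⊕-elim P X Y left right K k with ∈opt-⊕⁻ X Y k
... | inj₁ (X' , x' , refl) = left X' x'
... | inj₂ (Y' , y' , refl) = right Y' y'

NonZero-⊕ : ∀ X Y → NonZeroGame X → NonZeroGame (X ⊕ Y)
NonZero-⊕ X Y (X' , x') = X' ⊕ Y , ∈opt-⊕⁺ˡ X Y x'

allN-intro : ∀ gs → (∀ {g} → g ∈ gs → isP g ≡ false) → allN gs ≡ true
allN-intro []       h = refl
allN-intro (g ∷ gs) h rewrite h (here refl) = allN-intro gs (h ∘ there)

allN-elim : ∀ gs → allN gs ≡ true → ∀ {g} → g ∈ gs → isP g ≡ false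
allN-elim (g ∷ gs) e (here refl) with isP g | e
... | false | _  = refl
... | true  | ()
allN-elim (g ∷ gs) e (there m) with isP g | e
... | false | e' = allN-elim gs e' m
... | true  | ()

isP-intro : ∀ X → NonZeroGame X → (∀ X' → X' ∈opt X → isP X' ≡ false) → isP X ≡ true
isP-intro (mk (g ∷ gs)) _ h = allN-intro (g ∷ gs) (h _)

isP-elim : ∀ X → isP X ≡ true → ∀ {X'} → X' ∈opt X → isP X' ≡ false
isP-elim (mk (g ∷ gs)) e = allN-elim (g ∷ gs) e

isP-nonzero : ∀ X → isP X ≡ true → NonZeroGame X
isP-nonzero (mk (g ∷ gs)) _ = g , here refl

-- Equality of games as hereditary sets of options: the order and multiplicity of the lists
-- under `mk` are irrelevant.
infix 4 _≅_
data _≅_ : Game → Game → Set where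
  bisim : ∀ {X Y} → (∀ X' → X' ∈opt X → Σ Game λ Y' → Y' ∈opt Y × X' ≅ Y')
                  → (∀ Y' → Y' ∈opt Y → Σ Game λ X' → X' ∈opt X × X' ≅ Y')
                  → X ≅ Y

≅-refl : ∀ {X} → X ≅ X
≅-refl {X} = game-ind (λ X → X ≅ X) step X
  where
  step : ∀ X → (∀ X' → X' ∈opt X → X' ≅ X') → X ≅ X
  step X ih = bisim (λ X' x' → X' , x' , ih X' x') (λ X' x' → X' , x' , ih X' x')

≅-sym : ∀ {X Y} → X ≅ Y → Y ≅ X
≅-sym (bisim f g) =
  bisim (λ Y' y' → let (X' , x' , p) = g Y' y' in X' , x' , ≅-sym p)
        (λ X' x' → let (Y' , y' , p) = f X' x' in Y' , y' , ≅-sym p)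

≅-trans : ∀ {X Y Z} → X ≅ Y → Y ≅ Z → X ≅ Z
≅-trans (bisim f g) (bisim f' g') =
  bisim (λ X' x' → let (Y' , y' , p) = f X' x' ; (Z' , z' , q) = f' Y' y' in Z' , z' , ≅-trans p q)
        (λ Z' z' → let (Y' , y' , q) = g' Z' z' ; (X' , x' , p) = g Y' y' in X' , x' , ≅-trans p q)

≅-setoid : Setoid _ _
≅-setoid = record { _≈_ = _≅_ ; isEquivalence = record { refl = ≅-refl ; sym = ≅-sym ; trans = ≅-trans } }

module ≅-Reasoning = SetoidReasoning ≅-setoid

isP-cong : ∀ {X Y} → X ≅ Y → isP X ≡ isP Y
isP-cong {X} {Y} (bisim f g) = ⇔→≡ (mk⇔ X⇒Y Y⇒X)
  where
  X⇒Y : isP X ≡ true → isP Y ≡ true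
  X⇒Y e with isP-nonzero X e
  ... | X₀ , x₀ = let (Y₀ , y₀ , _) = f X₀ x₀ in
    isP-intro Y (Y₀ , y₀) λ Y' y' → let (X' , x' , p) = g Y' y' in trans (sym (isP-cong p)) (isP-elim X e x')

  Y⇒X : isP Y ≡ true → isP X ≡ true
  Y⇒X e with isP-nonzero Y e
  ... | Y₀ , y₀ = let (X₀ , x₀ , _) = g Y₀ y₀ in
    isP-intro X (X₀ , x₀) λ X' x' → let (Y' , y' , p) = f X' x' in trans (isP-cong p) (isP-elim Y e y')

⊕-cong : ∀ {X X' Y Y'} → X ≅ X' → Y ≅ Y' → X ⊕ Y ≅ X' ⊕ Y'
⊕-cong {X} {X'} {Y} {Y'} p@(bisim f g) q@(bisim f' g') = bisim
  (∈opt-⊕-elim (λ K → Σ Game λ K' → K' ∈opt (X' ⊕ Y') × K ≅ K') X Y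
    (λ X₁ x₁ → let (X₁' , x₁' , r) = f X₁ x₁ in X₁' ⊕ Y' , ∈opt-⊕⁺ˡ X' Y' x₁' , ⊕-cong r q)
    (λ Y₁ y₁ → let (Y₁' , y₁' , r) = f' Y₁ y₁ in X' ⊕ Y₁' , ∈opt-⊕⁺ʳ X' Y' y₁' , ⊕-cong p r))
  (∈opt-⊕-elim (λ K' → Σ Game λ K → K ∈opt (X ⊕ Y) × K ≅ K') X' Y'
    (λ X₁' x₁' → let (X₁ , x₁ , r) = g X₁' x₁' in X₁ ⊕ Y , ∈opt-⊕⁺ˡ X Y x₁ , ⊕-cong r q)
    (λ Y₁' y₁' → let (Y₁ , y₁ , r) = g' Y₁' y₁' in X ⊕ Y₁ , ∈opt-⊕⁺ʳ X Y y₁ , ⊕-cong p r))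

⊕-comm : ∀ X Y → X ⊕ Y ≅ Y ⊕ X
⊕-comm = game-ind (λ X → ∀ Y → X ⊕ Y ≅ Y ⊕ X) λ X ihX →
         game-ind (λ Y → X ⊕ Y ≅ Y ⊕ X) λ Y ihY →
  bisim (∈opt-⊕-elim _ X Y
          (λ X' x' → Y ⊕ X' , ∈opt-⊕⁺ʳ Y X x' , ihX X' x' Y)
          (λ Y' y' → Y' ⊕ X , ∈opt-⊕⁺ˡ Y X y' , ihY Y' y'))
        (∈opt-⊕-elim _ Y X
          (λ Y' y' → X ⊕ Y' , ∈opt-⊕⁺ʳ X Y y' , ihY Y' y')
          (λ X' x' → X' ⊕ Y , ∈opt-⊕⁺ˡ X Y x' , ihX X' x' Y))

⊕-assoc : ∀ X Y Z → (X ⊕ Y) ⊕ Z ≅ X ⊕ (Y ⊕ Z)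
⊕-assoc = game-ind (λ X → ∀ Y Z → (X ⊕ Y) ⊕ Z ≅ X ⊕ (Y ⊕ Z)) λ X ihX →
          game-ind (λ Y → ∀ Z → (X ⊕ Y) ⊕ Z ≅ X ⊕ (Y ⊕ Z)) λ Y ihY →
          game-ind (λ Z → (X ⊕ Y) ⊕ Z ≅ X ⊕ (Y ⊕ Z)) λ Z ihZ →
  bisim (∈opt-⊕-elim _ (X ⊕ Y) Z
          (∈opt-⊕-elim (λ S → Σ Game λ K' → K' ∈opt (X ⊕ (Y ⊕ Z)) × S ⊕ Z ≅ K') X Y
            (λ X' x' → X' ⊕ (Y ⊕ Z) , ∈opt-⊕⁺ˡ X (Y ⊕ Z) x' , ihX X' x' Y Z)
            (λ Y' y' → X ⊕ (Y' ⊕ Z) , ∈opt-⊕⁺ʳ X (Y ⊕ Z) (∈opt-⊕⁺ˡ Y Z y') , ihY Y' y' Z))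
          (λ Z' z' → X ⊕ (Y ⊕ Z') , ∈opt-⊕⁺ʳ X (Y ⊕ Z) (∈opt-⊕⁺ʳ Y Z z') , ihZ Z' z'))
        (∈opt-⊕-elim _ X (Y ⊕ Z)
          (λ X' x' → (X' ⊕ Y) ⊕ Z , ∈opt-⊕⁺ˡ (X ⊕ Y) Z (∈opt-⊕⁺ˡ X Y x') , ihX X' x' Y Z)
          (∈opt-⊕-elim (λ S → Σ Game λ K → K ∈opt ((X ⊕ Y) ⊕ Z) × K ≅ X ⊕ S) Y Z
            (λ Y' y' → (X ⊕ Y') ⊕ Z , ∈opt-⊕⁺ˡ (X ⊕ Y) Z (∈opt-⊕⁺ʳ X Y y') , ihY Y' y' Z)
            (λ Z' z' → (X ⊕ Y) ⊕ Z' , ∈opt-⊕⁺ʳ (X ⊕ Y) Z z' , ihZ Z' z')))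

⊕-identityˡ : ∀ X → 𝟘 ⊕ X ≅ X
⊕-identityˡ = game-ind (λ X → 𝟘 ⊕ X ≅ X) λ X ih →
  bisim (∈opt-⊕-elim _ 𝟘 X (λ _ ()) (λ X' x' → X' , x' , ih X' x'))
        (λ X' x' → 𝟘 ⊕ X' , ∈opt-⊕⁺ʳ 𝟘 X x' , ih X' x')

⊕-identityʳ : ∀ X → X ⊕ 𝟘 ≅ X
⊕-identityʳ X = ≅-trans (⊕-comm X 𝟘) (⊕-identityˡ X)

⊕-isCommutativeMonoid : IsCommutativeMonoid _≅_ _⊕_ 𝟘
⊕-isCommutativeMonoid = record
  { isMonoid = record
    { isSemigroup = record
      { isMagma = record { isEquivalence = Setoid.isEquivalence ≅-setoid ; ∙-cong = ⊕-cong }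
      ; assoc   = ⊕-assoc
      }
    ; identity = ⊕-identityˡ , ⊕-identityʳ
    }
  ; comm = ⊕-comm
  }

⊕-commutativeMonoid : CommutativeMonoid _ _
⊕-commutativeMonoid = record { isCommutativeMonoid = ⊕-isCommutativeMonoid }

open import Algebra.Properties.CommutativeSemigroup (CommutativeMonoid.commutativeSemigroup ⊕-commutativeMonoid)
  using (interchange; x∙yz≈y∙xz; xy∙z≈y∙xz)

times-+ : ∀ X k l → times k X ⊕ times l X ≅ times (k + l) X
times-+ X zero    l = ⊕-identityˡ (times l X)
times-+ X (suc k) l = ≅-trans (⊕-assoc X (times k X) (times l X)) (⊕-cong ≅-refl (times-+ X k l))

∈opt-times-suc : ∀ n X {K} → K ∈opt times (suc n) X
  → Σ Game λ X' → X' ∈opt X × K ≅ X' ⊕ times n X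
∈opt-times-suc n X {K} = ∈opt-⊕-elim _ X (times n X) (λ X' x' → X' , x' , ≅-refl) (rest n) K
  where
  rest : ∀ n K → K ∈opt times n X → Σ Game λ X' → X' ∈opt X × X ⊕ K ≅ X' ⊕ times n X
  rest zero    K ()
  rest (suc n) K k = let (X' , x' , p) = ∈opt-times-suc n X k in
    X' , x' , ≅-trans (⊕-cong ≅-refl p) (x∙yz≈y∙xz X X' (times n X))

private
  variable
    𝒜 𝒟 : Game → Set
    A B K K' W X X' Y : Game

SumClosed : (Game → Set) → Set
SumClosed 𝒜 = ∀ K L → 𝒜 K → 𝒜 L → 𝒜 (K ⊕ L)

OptionClosed : (Game → Set) → Set
OptionClosed 𝒜 = ∀ K K' → 𝒜 K → K' ∈opt K → 𝒜 K'

𝟘-closed : OptionClosed 𝒜 → 𝒜 X → 𝒜 𝟘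
𝟘-closed {X = mk []}      opt-closed x = x
𝟘-closed {X = mk (y ∷ _)} opt-closed x = 𝟘-closed opt-closed (opt-closed _ y x (here refl))

times-closed : SumClosed 𝒜 → 𝒜 𝟘 → 𝒜 X → ∀ n → 𝒜 (times n X)
times-closed sum-closed z x zero    = z
times-closed sum-closed z x (suc n) = sum-closed _ _ x (times-closed sum-closed z x n)

≈-setoid : (Game → Set) → Setoid _ _
≈-setoid 𝒜 = record
  { _≈_           = _≈[ 𝒜 ]_
  ; isEquivalence = record
    { refl  = λ Z z → refl
    ; sym   = λ p Z z → sym (p Z z)
    ; trans = λ p q Z z → trans (p Z z) (q Z z)
    }
  }

module ≈-Reasoning (𝒜 : Game → Set) = SetoidReasoning (≈-setoid 𝒜)

≅⇒≈ : X ≅ Y → X ≈[ 𝒜 ] Y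
≅⇒≈ p Z z = isP-cong (⊕-cong p ≅-refl)

≈-⊕ʳ : SumClosed 𝒜 → ∀ X Y → X ≈[ 𝒜 ] Y → 𝒜 B → (X ⊕ B) ≈[ 𝒜 ] (Y ⊕ B)
≈-⊕ʳ {B = B} sum-closed X Y X≈Y b Z z = begin
  isP ((X ⊕ B) ⊕ Z) ≡⟨ isP-cong (⊕-assoc X B Z) ⟩
  isP (X ⊕ (B ⊕ Z)) ≡⟨ X≈Y (B ⊕ Z) (sum-closed B Z b z) ⟩
  isP (Y ⊕ (B ⊕ Z)) ≡⟨ isP-cong (⊕-assoc Y B Z) ⟨
  isP ((Y ⊕ B) ⊕ Z) ∎
  where open ≡-Reasoning

≈-⊕ˡ : SumClosed 𝒜 → 𝒜 B → ∀ X Y → X ≈[ 𝒜 ] Y → (B ⊕ X) ≈[ 𝒜 ] (B ⊕ Y)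
≈-⊕ˡ {𝒜 = 𝒜} {B = B} sum-closed b X Y X≈Y = begin
  B ⊕ X ≈⟨ ≅⇒≈ (⊕-comm B X) ⟩
  X ⊕ B ≈⟨ ≈-⊕ʳ sum-closed X Y X≈Y b ⟩
  Y ⊕ B ≈⟨ ≅⇒≈ (⊕-comm Y B) ⟩
  B ⊕ Y ∎
  where open ≈-Reasoning 𝒜

≈-context : ∀ X Y → X ≈[ 𝒜 ] Y → ∀ Z → 𝒜 Z → isP (Z ⊕ X) ≡ isP (Z ⊕ Y)
≈-context X Y X≈Y Z z = begin
  isP (Z ⊕ X) ≡⟨ isP-cong (⊕-comm Z X) ⟩
  isP (X ⊕ Z) ≡⟨ X≈Y Z z ⟩
  isP (Y ⊕ Z) ≡⟨ isP-cong (⊕-comm Y Z) ⟩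
  isP (Z ⊕ Y) ∎
  where open ≡-Reasoning

InM-⊕ʳ : SumClosed 𝒜 → 𝒜 B → ∀ X Y → InM 𝒜 X Y → InM 𝒜 (X ⊕ B) (Y ⊕ B)
InM-⊕ʳ {B = B} sum-closed b X Y meximal (Z , z , p , q) =
  meximal (B ⊕ Z , sum-closed B Z b z ,
           trans (sym (isP-cong (⊕-assoc X B Z))) p , trans (sym (isP-cong (⊕-assoc Y B Z))) q)

InM-resp-≈ : ∀ X X' Y Y' → X ≈[ 𝒜 ] X' → Y ≈[ 𝒜 ] Y' → InM 𝒜 X Y → InM 𝒜 X' Y'
InM-resp-≈ X X' Y Y' X≈X' Y≈Y' meximal (Z , z , p , q) =
  meximal (Z , z , trans (X≈X' Z z) p , trans (Y≈Y' Z z) q)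

infix 4 _⊆″[_]_
_⊆″[_]_ : Game → (Game → Set) → Game → Set
Y ⊆″[ 𝒜 ] X = ∀ Y' → Y' ∈opt Y → Σ Game λ X' → X' ∈opt X × Y' ≈[ 𝒜 ] X'

⊆″-resp-≅ : ∀ Y X → Y ⊆″[ 𝒜 ] X → X ≅ X' → Y ⊆″[ 𝒜 ] X'
⊆″-resp-≅ {𝒜 = 𝒜} Y X Y⊆X (bisim f g) Y' y' =
  let (X₁ , x₁ , Y'≈X₁) = Y⊆X Y' y' ; (X₁' , x₁' , X₁≅X₁') = f X₁ x₁ in
  X₁' , x₁' , (begin Y' ≈⟨ Y'≈X₁ ⟩ X₁ ≈⟨ ≅⇒≈ X₁≅X₁' ⟩ X₁' ∎)
  where open ≈-Reasoning 𝒜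

⊆″-⊕ʳ : SumClosed 𝒜 → OptionClosed 𝒜 → ∀ Y X → Y ⊆″[ 𝒜 ] X → Y ≈[ 𝒜 ] X → 𝒜 A
  → Y ⊕ A ⊆″[ 𝒜 ] X ⊕ A
⊆″-⊕ʳ {A = A} sum-closed opt-closed Y X Y⊆X Y≈X a = ∈opt-⊕-elim _ Y A
  (λ Y' y' → let (X' , x' , Y'≈X') = Y⊆X Y' y' in
    X' ⊕ A , ∈opt-⊕⁺ˡ X A x' , ≈-⊕ʳ sum-closed Y' X' Y'≈X' a)
  (λ A' a' → X ⊕ A' , ∈opt-⊕⁺ʳ X A a' , ≈-⊕ʳ sum-closed Y X Y≈X (opt-closed A A' a a'))

≈-from-options : OptionClosed 𝒜 → ∀ S R → NonZeroGame S → NonZeroGame R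
  → R ⊆″[ 𝒜 ] S → (∀ S' → S' ∈opt S → InM 𝒜 R S') → S ≈[ 𝒜 ] R
≈-from-options {𝒜 = 𝒜} opt-closed S R S≠𝟘 R≠𝟘 R⊆S meximal =
  game-ind (λ A → 𝒜 A → isP (S ⊕ A) ≡ isP (R ⊕ A)) λ A ih a →
    ⇔→≡ (mk⇔ (S⇒R A ih a) (R⇒S A ih a))
  where
  module _ A (ih : ∀ A' → A' ∈opt A → 𝒜 A' → isP (S ⊕ A') ≡ isP (R ⊕ A')) (a : 𝒜 A) where
    ih′ : ∀ A' → A' ∈opt A → isP (S ⊕ A') ≡ isP (R ⊕ A')
    ih′ A' a' = ih A' a' (opt-closed A A' a a')

    R⇒S : isP (R ⊕ A) ≡ true → isP (S ⊕ A) ≡ true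
    R⇒S p = isP-intro (S ⊕ A) (NonZero-⊕ S A S≠𝟘) (∈opt-⊕-elim _ S A
      (λ S' s' → ¬-not λ q → meximal S' s' (A , a , p , q))
      (λ A' a' → trans (ih′ A' a') (isP-elim (R ⊕ A) p (∈opt-⊕⁺ʳ R A a'))))

    S⇒R : isP (S ⊕ A) ≡ true → isP (R ⊕ A) ≡ true
    S⇒R p = isP-intro (R ⊕ A) (NonZero-⊕ R A R≠𝟘) (∈opt-⊕-elim _ R A
      (λ R' r' → let (S' , s' , R'≈S') = R⊆S R' r' in
        trans (R'≈S' A a) (isP-elim (S ⊕ A) p (∈opt-⊕⁺ˡ S A s')))
      (λ A' a' → trans (sym (ih′ A' a')) (isP-elim (S ⊕ A) p (∈opt-⊕⁺ʳ S A a'))))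

TimesPlus : (Game → Set) → Game → Game → Set
TimesPlus 𝒜 X K = Σ ℕ λ k → Σ Game λ A → 𝒜 A × K ≅ times k X ⊕ A

module _ (sum-closed : SumClosed 𝒜) (opt-closed : OptionClosed 𝒜)
         (X'∈𝒜 : ∀ X' → X' ∈opt X → 𝒜 X') where

  TimesPlus-⊕ : TimesPlus 𝒜 X K → TimesPlus 𝒜 X Y → TimesPlus 𝒜 X (K ⊕ Y)
  TimesPlus-⊕ {K = K} {Y = Y} (k , A , a , K≅) (l , B , b , Y≅) = k + l , A ⊕ B , sum-closed A B a b , (begin
    K ⊕ Y                               ≈⟨ ⊕-cong K≅ Y≅ ⟩
    (times k X ⊕ A) ⊕ (times l X ⊕ B)   ≈⟨ interchange (times k X) A (times l X) B ⟩
    (times k X ⊕ times l X) ⊕ (A ⊕ B)   ≈⟨ ⊕-cong (times-+ X k l) ≅-refl ⟩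
    times (k + l) X ⊕ (A ⊕ B)           ∎)
    where open ≅-Reasoning

  TimesPlus-opt : TimesPlus 𝒜 X K → K' ∈opt K → TimesPlus 𝒜 X K'
  TimesPlus-opt {K' = K'} (k , A , a , bisim f g) k' =
    let (M , m , K'≅M) = f K' k' ; (i , B , b , M≅) = opt-of-times⊕ k M m in
    i , B , b , ≅-trans K'≅M M≅
    where
    moved-in-times : ∀ k K₁ → K₁ ∈opt times k X → TimesPlus 𝒜 X (K₁ ⊕ A)
    moved-in-times zero    K₁ ()
    moved-in-times (suc i) K₁ k₁ = let (X' , x' , K₁≅) = ∈opt-times-suc i X k₁ in
      i , X' ⊕ A , sum-closed X' A (X'∈𝒜 X' x') a ,
      ≅-trans (⊕-cong K₁≅ ≅-refl) (xy∙z≈y∙xz X' (times i X) A)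

    opt-of-times⊕ : ∀ k M → M ∈opt (times k X ⊕ A) → TimesPlus 𝒜 X M
    opt-of-times⊕ k = ∈opt-⊕-elim _ (times k X) A (moved-in-times k)
      (λ A' a' → k , A' , opt-closed A A' a a' , ≅-refl)

  Cl⇒TimesPlus : 𝒜 𝟘 → Cl 𝒜 X K → TimesPlus 𝒜 X K
  Cl⇒TimesPlus z (base {K} a) = 0 , K , a , ≅-sym (⊕-identityˡ K)
  Cl⇒TimesPlus z gen          = 1 , 𝟘 , z , ≅-sym (≅-trans (⊕-identityʳ _) (⊕-identityʳ _))
  Cl⇒TimesPlus z (sum c d)    = TimesPlus-⊕ (Cl⇒TimesPlus z c) (Cl⇒TimesPlus z d)
  Cl⇒TimesPlus z (opt c k')   = TimesPlus-opt (Cl⇒TimesPlus z c) k'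

MexClause : (Game → Set) → (Game → Set) → Game → Game → Set
MexClause 𝒜 𝒟 W K = ∀ n → isP (times (suc n) W ⊕ K) ≡ false →
    (Σ Game λ K' → K' ∈opt K × isP (times (suc n) W ⊕ K') ≡ true)
  ⊎ (Σ Game λ W' → 𝒜 W' × 𝒟 W' × isP (times n W ⊕ W' ⊕ K) ≡ true)

MexClause-resp : SumClosed 𝒜 → OptionClosed 𝒜 → 𝒜 W → ∀ K K₀ → K ≈[ 𝒜 ] K₀ → K₀ ⊆″[ 𝒜 ] K
  → MexClause 𝒜 𝒟 W K₀ → MexClause 𝒜 𝒟 W K
MexClause-resp {𝒜 = 𝒜} {W = W} {𝒟 = 𝒟} sum-closed opt-closed w K K₀ K≈K₀ K₀⊆K clause n e =
  Sum.map transfer-option transfer-W'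
    (clause n (trans (sym (≈-context K K₀ K≈K₀ _ (nW∈𝒜 (suc n)))) e))
  where
  nW∈𝒜 : ∀ n → 𝒜 (times n W)
  nW∈𝒜 = times-closed sum-closed (𝟘-closed opt-closed w) w

  transfer-option : (Σ Game λ K₀' → K₀' ∈opt K₀ × isP (times (suc n) W ⊕ K₀') ≡ true)
                  → (Σ Game λ K' → K' ∈opt K × isP (times (suc n) W ⊕ K') ≡ true)
  transfer-option (K₀' , k₀' , p) = let (K' , k' , K₀'≈K') = K₀⊆K K₀' k₀' in
    K' , k' , trans (sym (≈-context K₀' K' K₀'≈K' _ (nW∈𝒜 (suc n)))) p

  transfer-W' : (Σ Game λ W' → 𝒜 W' × 𝒟 W' × isP (times n W ⊕ W' ⊕ K₀) ≡ true)
              → (Σ Game λ W' → 𝒜 W' × 𝒟 W' × isP (times n W ⊕ W' ⊕ K) ≡ true)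
  transfer-W' (W' , w' , d , p) =
    W' , w' , d , trans (≈-context K K₀ K≈K₀ _ (sum-closed _ W' (nW∈𝒜 n) w')) p

module Exchange (sum-closed : SumClosed 𝒜) (opt-closed : OptionClosed 𝒜) (G H : Game)
  (G'∈𝒜 : ∀ G' → G' ∈opt G → 𝒜 G') (H∈𝒜 : 𝒜 H) (H≠𝟘 : NonZeroGame H)
  (H⊆G : H ⊆″[ 𝒜 ] G) (meximal : ∀ G' → G' ∈opt G → InM 𝒜 H G') where

  open ≈-Reasoning 𝒜

  𝟘∈𝒜 : 𝒜 𝟘
  𝟘∈𝒜 = 𝟘-closed opt-closed H∈𝒜

  jH∈𝒜 : ∀ j → 𝒜 (times j H)
  jH∈𝒜 = times-closed sum-closed 𝟘∈𝒜 H∈𝒜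

  G≠𝟘 : NonZeroGame G
  G≠𝟘 = let (G' , g' , _) = H⊆G (proj₁ H≠𝟘) (proj₂ H≠𝟘) in G' , g'

  -- Simultaneous induction on j: the clauses at j use times-≈ j and G⊕jG≈H⊕jG below j only.
  times-≈ : ∀ j → times j G ≈[ 𝒜 ] times j H
  G⊕jG≈H⊕jG : ∀ j → (G ⊕ times j G) ≈[ 𝒜 ] (H ⊕ times j G)
  H⊕jG⊆G⊕jG : ∀ j → H ⊕ times j G ⊆″[ 𝒜 ] G ⊕ times j G
  G⊕jG-meximal : ∀ j S' → S' ∈opt (G ⊕ times j G) → InM 𝒜 (H ⊕ times j G) S'

  X⊕jG≈X⊕jH : ∀ j X → 𝒜 X → (X ⊕ times j G) ≈[ 𝒜 ] (X ⊕ times j H)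
  X⊕jG≈X⊕jH j X x = ≈-⊕ˡ sum-closed x (times j G) (times j H) (times-≈ j)

  H'⊕jH≈G'⊕jG : ∀ j H' → H' ∈opt H
    → Σ Game λ G' → G' ∈opt G × (H' ⊕ times j H) ≈[ 𝒜 ] (G' ⊕ times j G)
  H'⊕jH≈G'⊕jG j H' h' = let (G' , g' , H'≈G') = H⊆G H' h' in G' , g' , (begin
    H' ⊕ times j H ≈⟨ ≈-⊕ʳ sum-closed H' G' H'≈G' (jH∈𝒜 j) ⟩
    G' ⊕ times j H ≈⟨ X⊕jG≈X⊕jH j G' (G'∈𝒜 G' g') ⟨
    G' ⊕ times j G ∎)

  times-≈ zero    = begin 𝟘 ∎
  times-≈ (suc j) = begin
    G ⊕ times j G ≈⟨ G⊕jG≈H⊕jG j ⟩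
    H ⊕ times j G ≈⟨ X⊕jG≈X⊕jH j H H∈𝒜 ⟩
    H ⊕ times j H ∎

  G⊕jG≈H⊕jG j = ≈-from-options opt-closed (G ⊕ times j G) (H ⊕ times j G)
    (NonZero-⊕ G (times j G) G≠𝟘) (NonZero-⊕ H (times j G) H≠𝟘) (H⊕jG⊆G⊕jG j) (G⊕jG-meximal j)

  H⊕jG⊆G⊕jG j = ∈opt-⊕-elim _ H (times j G) moved-in-H (moved-in-times j)
    where
    moved-in-H : ∀ H' → H' ∈opt H
      → Σ Game λ S' → S' ∈opt (G ⊕ times j G) × (H' ⊕ times j G) ≈[ 𝒜 ] S'
    moved-in-H H' h' = let (G' , g' , H'⊕jH≈G'⊕jG) = H'⊕jH≈G'⊕jG j H' h' in
      G' ⊕ times j G , ∈opt-⊕⁺ˡ G (times j G) g' , (begin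
        H' ⊕ times j G ≈⟨ X⊕jG≈X⊕jH j H' (opt-closed H H' H∈𝒜 h') ⟩
        H' ⊕ times j H ≈⟨ H'⊕jH≈G'⊕jG ⟩
        G' ⊕ times j G ∎)

    moved-in-times : ∀ k K → K ∈opt times k G
      → Σ Game λ S' → S' ∈opt (G ⊕ times k G) × (H ⊕ K) ≈[ 𝒜 ] S'
    moved-in-times zero    K ()
    moved-in-times (suc i) K k = let (G' , g' , K≅) = ∈opt-times-suc i G k in
      G' ⊕ times (suc i) G , ∈opt-⊕⁺ˡ G (times (suc i) G) g' , (begin
        H ⊕ K                ≈⟨ ≅⇒≈ (⊕-cong (≅-refl {H}) K≅) ⟩
        H ⊕ (G' ⊕ times i G) ≈⟨ ≅⇒≈ (x∙yz≈y∙xz H G' (times i G)) ⟩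
        G' ⊕ (H ⊕ times i G) ≈⟨ ≈-⊕ˡ sum-closed (G'∈𝒜 G' g') _ _ (G⊕jG≈H⊕jG i) ⟨
        G' ⊕ (G ⊕ times i G) ∎)

  G⊕jG-meximal j S' s' = let (G' , g' , S'≅) = ∈opt-times-suc j G s' in
    InM-resp-≈ (H ⊕ times j H) (H ⊕ times j G) (G' ⊕ times j H) S'
      (begin H ⊕ times j H ≈⟨ X⊕jG≈X⊕jH j H H∈𝒜 ⟨ H ⊕ times j G ∎)
      (begin
        G' ⊕ times j H ≈⟨ X⊕jG≈X⊕jH j G' (G'∈𝒜 G' g') ⟨
        G' ⊕ times j G ≈⟨ ≅⇒≈ (≅-sym S'≅) ⟩
        S'             ∎)
      (InM-⊕ʳ sum-closed (jH∈𝒜 j) H G' (meximal G' g'))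

  times-⊆″ : ∀ k → times k H ⊆″[ 𝒜 ] times k G
  times-⊆″ zero    K ()
  times-⊆″ (suc i) K k =
    let (H' , h' , K≅) = ∈opt-times-suc i H k ; (G' , g' , H'⊕iH≈G'⊕iG) = H'⊕jH≈G'⊕jG i H' h' in
    G' ⊕ times i G , ∈opt-⊕⁺ˡ G (times i G) g' , (begin
      K              ≈⟨ ≅⇒≈ K≅ ⟩
      H' ⊕ times i H ≈⟨ H'⊕iH≈G'⊕iG ⟩
      G' ⊕ times i G ∎)

  Cl-represented : Cl 𝒜 G K → Σ Game λ K₀ → 𝒜 K₀ × K ≈[ 𝒜 ] K₀ × K₀ ⊆″[ 𝒜 ] K
  Cl-represented {K} c = let (k , A , a , K≅) = Cl⇒TimesPlus sum-closed opt-closed G'∈𝒜 𝟘∈𝒜 c in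
    times k H ⊕ A , sum-closed (times k H) A (jH∈𝒜 k) a ,
    (begin
      K             ≈⟨ ≅⇒≈ K≅ ⟩
      times k G ⊕ A ≈⟨ ≈-⊕ʳ sum-closed (times k G) (times k H) (times-≈ k) a ⟩
      times k H ⊕ A ∎) ,
    ⊆″-resp-≅ (times k H ⊕ A) (times k G ⊕ A)
      (⊆″-⊕ʳ sum-closed opt-closed (times k H) (times k G) (times-⊆″ k)
        (begin times k H ≈⟨ times-≈ k ⟨ times k G ∎) a)
      (≅-sym K≅)

proposition5p10 : (𝒜 : Game → Set) → Closed 𝒜 → (G H : Game)
    → (∀ G' → G' ∈opt G → 𝒜 G')
    → 𝒜 H → NonZeroGame H
    → (∀ H' → H' ∈opt H → Σ Game λ G' → G' ∈opt G × H' ≈[ 𝒜 ] G')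
    → (∀ G' → G' ∈opt G → InM 𝒜 H G')
    → (𝒟 : Game → Set) → (W : Game) → 𝒜 W
    → IsMex 𝒜 𝒜 𝒟 W ⇔ IsMex 𝒜 (Cl 𝒜 G) 𝒟 W
proposition5p10 𝒜 (sum-closed , opt-closed) G H G'∈𝒜 H∈𝒜 H≠𝟘 H⊆G meximal 𝒟 W w = mk⇔
  (λ (inM , clause) → inM , λ K c →
    let (K₀ , k₀ , K≈K₀ , K₀⊆K) = Cl-represented c in
    MexClause-resp sum-closed opt-closed w K K₀ K≈K₀ K₀⊆K (clause K₀ k₀))
  (λ (inM , clause) → inM , λ K k → clause K (base k))
  where open Exchange sum-closed opt-closed G H G'∈𝒜 H∈𝒜 H≠𝟘 H⊆G meximal
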